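{- Let $p,q>0$ be integers, let $R=R(q,q)$, and let $G$ be a graph that is both $F_S^{p,q}$-free and $F_K^{p,q}$-free. Then $G$ has no induced subgraph isomorphic to any graph of the form $F_{p,R}$; that is, there do not exist pairwise disjoint sets $K_1,S_1,S_2,W\subseteq V(G)$ such that $K_1$ is a clique, $S_1,S_2$ are stable sets, $|K_1|=|S_1|=p$ and $K_1,S_1$ are matched, $|S_2|=|W|=R$ and $S_2,W$ are matched, $K_1$ is complete to $S_2$, and the only edges of $G[K_1\cup S_1\cup S_2\cup W]$ are those just described together with arbitrary edges between vertices of $W$.
   Context: All graphs are finite and simple. A clique is a set of pairwise adjacent vertices; a stable set is a set of pairwise non-adjacent vertices. For disjoint vertex sets $X,Y$: $X$ is complete to $Y$ if every vertex of $X$ is adjacent to every vertex of $Y$; $X$ and $Y$ are matched if every vertex of $X$ has exactly one neighbor in $Y$ and every vertex of $Y$ has exactly one neighbor in $X$. A graph $G$ is $H$-free if no induced subgraph of $G$ is isomorphic to $H$. $R(q,q)$ denotes the smallest positive integer $R$ such that every 2-coloring of the edges of the complete graph on $R$ vertices contains a monochromatic complete graph on $q$ vertices. The graph $F_S^{p,q}$ has vertex set $K\cup S_1\cup S_2\cup S_3$ (pairwise disjoint), where $K$ is a clique, $S_1,S_2,S_3$ are stable sets, $|K|=|S_1|=p$ and $K$ and $S_1$ are matched, $|S_2|=|S_3|=q$ and $S_2$ and $S_3$ are matched, $K$ is complete to $S_2$, and there are no other edges. The graph $F_K^{p,q}$ is obtained from $F_S^{p,q}$ by making all pairs of vertices of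 $S_3$ adjacent. For $a,b\in\mathbb{N}$, a graph $F_{a,b}$ has vertex set $K_1\cup S_1\cup S_2\cup W$ (pairwise disjoint), where $K_1$ is a clique, $S_1,S_2$ are stable sets, $|K_1|=|S_1|=a$ and $K_1,S_1$ are matched, $|S_2|=|W|=b$ and $S_2,W$ are matched, $K_1$ is complete to $S_2$, adjacency among pairs of vertices of $W$ is unrestricted, and there are no other edges. -}

module Defs where

open import Data.Nat using (ℕ; _≤_)
open import Data.Fin using (Fin; _≟_)
open import Data.Bool using (Bool; true; false; not)
open import Data.Sum using (_⊎_; inj₁; inj₂)
open import Data.Product using (Σ; _×_; ∃)
open import Relation.Nullary using (¬_)
open import Relation.Nullary.Decidable using (⌊_⌋)
open import Relation.Binary.PropositionalEquality using (_≡_; _≢_)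
open import Function.Definitions using (Injective)

record Graph : Set where
  field
    n      : ℕ
    adj    : Fin n → Fin n → Bool
    sym    : ∀ u v → adj u v ≡ adj v u
    irrefl : ∀ v → adj v v ≡ false

open Graph public

HasInduced : (G : Graph) (V : Set) (adjH : V → V → Bool) → Set
HasInduced G V adjH =
  Σ (V → Fin (n G)) λ f →
    Injective _≡_ _≡_ f × (∀ u v → adj G (f u) (f v) ≡ adjH u v)

-- Vertex set of the graphs F: K ⊎ S₁ ⊎ S₂ ⊎ W (W plays the role of S₃).
FV : ℕ → ℕ → Set
FV a b = Fin a ⊎ (Fin a ⊎ (Fin b ⊎ Fin b))

Fadj : (a b : ℕ) → (Fin b → Fin b → Bool) → FV a b → FV a b → Bool
Fadj a b w (inj₁ i)               (inj₁ j)               = not ⌊ i ≟ j ⌋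
Fadj a b w (inj₁ i)               (inj₂ (inj₁ j))        = ⌊ i ≟ j ⌋
Fadj a b w (inj₂ (inj₁ i))        (inj₁ j)               = ⌊ i ≟ j ⌋
Fadj a b w (inj₁ i)               (inj₂ (inj₂ (inj₁ j))) = true
Fadj a b w (inj₂ (inj₂ (inj₁ i))) (inj₁ j)               = true
Fadj a b w (inj₂ (inj₂ (inj₁ i))) (inj₂ (inj₂ (inj₂ j))) = ⌊ i ≟ j ⌋
Fadj a b w (inj₂ (inj₂ (inj₂ i))) (inj₂ (inj₂ (inj₁ j))) = ⌊ i ≟ j ⌋
Fadj a b w (inj₂ (inj₂ (inj₂ i))) (inj₂ (inj₂ (inj₂ j))) = w i j
Fadj a b w _                      _                      = false

FSadj : (p q : ℕ) → FV p q → FV p q → Bool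
FSadj p q = Fadj p q (λ _ _ → false)

FKadj : (p q : ℕ) → FV p q → FV p q → Bool
FKadj p q = Fadj p q (λ i j → not ⌊ i ≟ j ⌋)

-- Every 2-colouring of the edges of K_R has a monochromatic K_q.
-- A 2-colouring is a symmetric map c on pairs (diagonal values irrelevant).
RamseyProperty : ℕ → ℕ → Set
RamseyProperty q R =
  (c : Fin R → Fin R → Bool) → (∀ i j → c i j ≡ c j i) →
  ∃ λ (b : Bool) → Σ (Fin q → Fin R) λ g →
    Injective _≡_ _≡_ g × (∀ i j → i ≢ j → c (g i) (g j) ≡ b)

IsRamseyNumber : ℕ → ℕ → Set
IsRamseyNumber q R =
  (1 ≤ R) × RamseyProperty q R × (∀ R' → 1 ≤ R' → RamseyProperty q R' → R ≤ R')

module Submission where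

-- Suppose G contains an induced copy of F_{p,R} with arbitrary
-- adjacency w inside W.  Because the copy is induced, w is the adjacency of
-- the simple graph G[W]: it is symmetric and irreflexive, so it is an edge
-- 2-colouring of the complete graph on R vertices.  The Ramsey property
-- yields q vertices of W on which w is constant off the diagonal, i.e. a
-- clique or a stable set.  Keeping only these q vertices of W together with
-- their matched partners in S₂ (and all of K₁, S₁) is an induced subgraph of
-- F_{p,R}, isomorphic to F_K^{p,q} or to F_S^{p,q} — a contradiction.

open import Defs
open import Data.Nat using (ℕ; _<_)
open import Data.Fin using (Fin; _≟_)
open import Data.Bool using (Bool; true; false; not; _∧_)
open import Data.Bool.Properties using (∧-zeroʳ; ∧-identityʳ)
open import Data.Sum using (inj₁; inj₂; map)
open import Data.Sum.Properties using (inj₁-injective; inj₂-injective)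
open import Data.Product using (_×_; _,_; proj₁; proj₂)
open import Function using (id; _∘_)
open import Function.Bundles using (mk⇔)
open import Relation.Nullary using (¬_; yes; no; does)
open import Relation.Nullary.Decidable using (⌊_⌋; does-⇔; isYes≗does)
open import Relation.Binary.PropositionalEquality
  using (_≡_; _≢_; refl; cong; trans; module ≡-Reasoning) renaming (sym to ≡-sym)
open import Function.Definitions using (Injective)

IsInducedEmbedding : {U V : Set} → (U → U → Bool) → (V → V → Bool) →
                     (U → V) → Set
IsInducedEmbedding adjU adjV m =
  Injective _≡_ _≡_ m × (∀ u v → adjV (m u) (m v) ≡ adjU u v)

induced-trans : (G : Graph) {U V : Set} {adjU : U → U → Bool}
  {adjV : V → V → Bool} (m : U → V) → IsInducedEmbedding adjU adjV m →
  HasInduced G V adjV → HasInduced G U adjU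
induced-trans G m (m-inj , m-adj) (f , f-inj , f-adj) =
  f ∘ m , m-inj ∘ f-inj , λ u v → trans (f-adj (m u) (m v)) (m-adj u v)

induced-sym : (G : Graph) {U : Set} {adjU : U → U → Bool} →
  HasInduced G U adjU → ∀ u v → adjU u v ≡ adjU v u
induced-sym G (f , _ , f-adj) u v =
  trans (≡-sym (f-adj u v)) (trans (Graph.sym G (f u) (f v)) (f-adj v u))

induced-irrefl : (G : Graph) {U : Set} {adjU : U → U → Bool} →
  HasInduced G U adjU → ∀ u → adjU u u ≡ false
induced-irrefl G (f , _ , f-adj) u = trans (≡-sym (f-adj u u)) (irrefl G (f u))

≟-injective : ∀ {q b} {g : Fin q → Fin b} → Injective _≡_ _≡_ g →
  ∀ i j → ⌊ g i ≟ g j ⌋ ≡ ⌊ i ≟ j ⌋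
≟-injective {g = g} g-inj i j = begin
  ⌊ g i ≟ g j ⌋     ≡⟨ isYes≗does (g i ≟ g j) ⟩
  does (g i ≟ g j)  ≡⟨ does-⇔ (mk⇔ g-inj (cong g)) (g i ≟ g j) (i ≟ j) ⟩
  does (i ≟ j)      ≡⟨ ≡-sym (isYes≗does (i ≟ j)) ⟩
  ⌊ i ≟ j ⌋         ∎
  where open ≡-Reasoning

⊎-map-injective : {A B C D : Set} {f : A → C} {g : B → D} →
  Injective _≡_ _≡_ f → Injective _≡_ _≡_ g → Injective _≡_ _≡_ (map f g)
⊎-map-injective f-inj g-inj {inj₁ x} {inj₁ y} e = cong inj₁ (f-inj (inj₁-injective e))
⊎-map-injective f-inj g-inj {inj₂ x} {inj₂ y} e = cong inj₂ (g-inj (inj₂-injective e))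

restrictW : ∀ {a q b} → (Fin q → Fin b) → FV a q → FV a b
restrictW g = map id (map id (map g g))

restrictW-embedding : ∀ a {q b} {wq : Fin q → Fin q → Bool}
  {w : Fin b → Fin b → Bool} {g : Fin q → Fin b} →
  IsInducedEmbedding wq w g →
  IsInducedEmbedding (Fadj a q wq) (Fadj a b w) (restrictW g)
restrictW-embedding a {wq = wq} {w} {g} (g-inj , g-adj) = injective , adjacency
  where
  injective : Injective _≡_ _≡_ (restrictW g)
  injective = ⊎-map-injective id (⊎-map-injective id (⊎-map-injective g-inj g-inj))

  adjacency : ∀ u v → Fadj a _ w (restrictW g u) (restrictW g v)
                    ≡ Fadj a _ wq u v
  adjacency (inj₁ i)               (inj₁ j)               = refl
  adjacency (inj₁ i)               (inj₂ (inj₁ j))        = refl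
  adjacency (inj₁ i)               (inj₂ (inj₂ (inj₁ j))) = refl
  adjacency (inj₁ i)               (inj₂ (inj₂ (inj₂ j))) = refl
  adjacency (inj₂ (inj₁ i))        (inj₁ j)               = refl
  adjacency (inj₂ (inj₁ i))        (inj₂ (inj₁ j))        = refl
  adjacency (inj₂ (inj₁ i))        (inj₂ (inj₂ (inj₁ j))) = refl
  adjacency (inj₂ (inj₁ i))        (inj₂ (inj₂ (inj₂ j))) = refl
  adjacency (inj₂ (inj₂ (inj₁ i))) (inj₁ j)               = refl
  adjacency (inj₂ (inj₂ (inj₁ i))) (inj₂ (inj₁ j))        = refl
  adjacency (inj₂ (inj₂ (inj₁ i))) (inj₂ (inj₂ (inj₁ j))) = refl
  adjacency (inj₂ (inj₂ (inj₁ i))) (inj₂ (inj₂ (inj₂ j))) = ≟-injective g-inj i j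
  adjacency (inj₂ (inj₂ (inj₂ i))) (inj₁ j)               = refl
  adjacency (inj₂ (inj₂ (inj₂ i))) (inj₂ (inj₁ j))        = refl
  adjacency (inj₂ (inj₂ (inj₂ i))) (inj₂ (inj₂ (inj₁ j))) = ≟-injective g-inj i j
  adjacency (inj₂ (inj₂ (inj₂ i))) (inj₂ (inj₂ (inj₂ j))) = g-adj i j

W-simple : (G : Graph) {a b : ℕ} {w : Fin b → Fin b → Bool} →
  HasInduced G (FV a b) (Fadj a b w) →
  (∀ i j → w i j ≡ w j i) × (∀ i → w i i ≡ false)
W-simple G copy =
  (λ i j → induced-sym G copy (W i) (W j)) , (λ i → induced-irrefl G copy (W i))
  where
  W : ∀ {a b} → Fin b → FV a b
  W i = inj₂ (inj₂ (inj₂ i))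

homogeneous : ∀ {q} → Bool → Fin q → Fin q → Bool
homogeneous b i j = b ∧ not ⌊ i ≟ j ⌋

homogeneous-restriction : ∀ {q R} (w : Fin R → Fin R → Bool) →
  (∀ i → w i i ≡ false) → (b : Bool) (g : Fin q → Fin R) →
  (∀ i j → i ≢ j → w (g i) (g j) ≡ b) →
  ∀ i j → w (g i) (g j) ≡ homogeneous b i j
homogeneous-restriction w w-irrefl b g constant i j with i ≟ j
... | yes refl = trans (w-irrefl (g i)) (≡-sym (∧-zeroʳ b))
... | no i≢j   = trans (constant i j i≢j) (≡-sym (∧-identityʳ b))

theorem2p2 : (p q : ℕ) → 0 < p → 0 < q → (R : ℕ) → IsRamseyNumber q R →
    (G : Graph) → ¬ HasInduced G (FV p q) (FSadj p q) →
    ¬ HasInduced G (FV p q) (FKadj p q) →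
    (w : Fin R → Fin R → Bool) → ¬ HasInduced G (FV p R) (Fadj p R w)
theorem2p2 p q _ _ R isRamsey G noFS noFK w copy
  with w-sym , w-irrefl ← W-simple G copy
  with b , g , g-inj , constant ← proj₁ (proj₂ isRamsey) w w-sym
  = excluded b (induced-trans G (restrictW g)
      (restrictW-embedding p (g-inj , homogeneous-restriction w w-irrefl b g constant))
      copy)
  where
  excluded : ∀ b → ¬ HasInduced G (FV p q) (Fadj p q (homogeneous b))
  excluded false = noFS
  excluded true  = noFK
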